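{- Let $G$ be a finite abelian group of order $n$, let $L$ be a $d$-dimensional Latin hypercube of order $n$ indexed by $G$, let $d'>d$, and let $L'$ be the $d'$-dimensional $G$-extension of $L$. If $L$ has $m$ pairwise disjoint $(G,d')$-suitable diagonals, then $L'$ has $mn^{d'-d}$ pairwise disjoint transversals.
   Context: A $d$-dimensional hypercube of order $n$ indexed by $G$ is a map $H:G^d\to G$ with entries $(x_1,\dots,x_d;H(x_1,\dots,x_d))$; it is Latin if each line (set of entries obtained by fixing all but one coordinate) contains every element of $G$ as a symbol. A diagonal is a set of $n$ entries no two agreeing in any coordinate; a transversal is a diagonal with pairwise distinct symbols. For an entry $e=(x_1,\dots,x_d;\sigma)$, $\Delta(e)=\sigma-x_1-\cdots-x_d$; $G_+$ is the sum of all elements of $G$. A diagonal $D$ of $L$ is $(G,d')$-suitable if $\sum_{e\in D}\Delta(e)=(1-d')G_+$. The $d'$-dimensional $G$-extension of $L$ is the hypercube $L'(x_1,\dots,x_{d'})=L(x_1,\dots,x_d)+\sum_{i=d+1}^{d'}x_i$. -}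

module Defs where

open import Data.Nat using (ℕ; zero; suc; _<_; _≤_; _∸_; _^_) renaming (_*_ to _*ℕ_)
open import Data.Nat.Properties using (_<?_)
open import Data.Fin using (Fin; toℕ; inject≤)
open import Data.Vec using (Vec; lookup; tabulate; foldr; _[_]≔_)
open import Data.Product using (Σ; _×_; ∃; _,_)
open import Relation.Binary.PropositionalEquality using (_≡_; _≢_)
open import Relation.Nullary using (yes; no)
open import Algebra.Core using (Op₁; Op₂)
open import Algebra.Structures using (IsAbelianGroup)
open import Function.Definitions using (Injective)

-- A finite abelian group of order n, presented (up to isomorphism) on the carrier Fin n.
record FinAbGroup (n : ℕ) : Set where
  field
    _⊕_ : Op₂ (Fin n)
    0# : Fin n
    ⊖_ : Op₁ (Fin n)
    isAbelianGroup : IsAbelianGroup _≡_ _⊕_ 0# ⊖_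

  sumFin : {k : ℕ} → (Fin k → Fin n) → Fin n
  sumFin {zero} f = 0#
  sumFin {suc k} f = f Fin.zero ⊕ sumFin (λ i → f (Fin.suc i))

  _·_ : ℕ → Fin n → Fin n
  zero · g = 0#
  suc k · g = g ⊕ (k · g)

  G₊ : Fin n
  G₊ = sumFin (λ g → g)

  sumVec : {d : ℕ} → Vec (Fin n) d → Fin n
  sumVec = foldr _ _⊕_ 0#

Pos : ℕ → ℕ → Set
Pos n d = Vec (Fin n) d

Hypercube : ℕ → ℕ → Set
Hypercube n d = Pos n d → Fin n

IsLatin : {n d : ℕ} → Hypercube n d → Set
IsLatin {n} {d} H = ∀ (x : Pos n d) (i : Fin d) (s : Fin n) → ∃ λ (a : Fin n) → H (x [ i ]≔ a) ≡ s

-- A diagonal is given by the positions p k (k : Fin n) of its n entries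
-- (entry k is (p k ; H (p k))): n distinct entries, no two agreeing in any coordinate.
IsDiagonal : {n d : ℕ} → (Fin n → Pos n d) → Set
IsDiagonal {n} {d} p = Injective _≡_ _≡_ p × (∀ (i : Fin d) → Injective _≡_ _≡_ (λ k → lookup (p k) i))

IsTransversal : {n d : ℕ} → Hypercube n d → (Fin n → Pos n d) → Set
IsTransversal H p = IsDiagonal p × Injective _≡_ _≡_ (λ k → H (p k))

PairwiseDisjoint : {n d m : ℕ} → (Fin m → Fin n → Pos n d) → Set
PairwiseDisjoint {n} {d} {m} P = ∀ (j j' : Fin m) → j ≢ j' → ∀ (k k' : Fin n) → P j k ≢ P j' k'

module _ {n : ℕ} (G : FinAbGroup n) where
  open FinAbGroup G

  Δ : {d : ℕ} → Hypercube n d → Pos n d → Fin n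
  Δ H x = H x ⊕ (⊖ sumVec x)

  -- (G,d')-suitable: Σ_{e∈D} Δ(e) = (1-d')G₊ = G₊ - d'·G₊
  IsSuitable : {d : ℕ} → ℕ → Hypercube n d → (Fin n → Pos n d) → Set
  IsSuitable d' H p = IsDiagonal p × (sumFin (λ k → Δ H (p k)) ≡ G₊ ⊕ (⊖ (d' · G₊)))

  -- the d'-dimensional G-extension of H (d ≤ d'):
  -- L'(x₁,…,x_{d'}) = L(x₁,…,x_d) + x_{d+1} + … + x_{d'}
  extension : {d : ℕ} (d' : ℕ) → d ≤ d' → Hypercube n d → Hypercube n d'
  extension {d} d' d≤d' H x =
    H (tabulate (λ i → lookup x (inject≤ i d≤d')))
      ⊕ sumFin (λ (i : Fin d') → extra i)
    where
    extra : Fin d' → Fin n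
    extra i with toℕ i <? d
    ... | yes _ = 0#
    ... | no _ = lookup x i

-- Let D be a (G,d′)-suitable diagonal of L with entries (p k ; L (p k)), k ∈ G, and put
-- a k = L (p k) + (d′ − d − 1)·k. Every coordinate of a diagonal runs through G, so suitability
-- says exactly that Σ a = 0. By Hall's theorem there is then a permutation β of G such that
-- β + a is a permutation as well. For every shift s ∈ G^(d′−d) the positions
-- p k ++ (β k + s₀, k + s₁, …, k + s_{d′−d−1}) have pairwise distinct coordinates and the
-- pairwise distinct symbols β k + a k + Σ s in L′, so they form a transversal. A position
-- determines its diagonal, its k and its shift, hence the m·n^(d′−d) transversals are disjoint.

module Submission where

open import Defs
open import Data.Nat using (ℕ; _<_; _∸_; _^_; _*_)
open import Data.Nat.Properties using (<⇒≤)
open import Data.Fin using (Fin)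
open import Data.Product using (Σ; _×_)

open import Level using (0ℓ)
open import Algebra.Bundles using (AbelianGroup)
open import Data.Nat as ℕ using (zero; suc; _+_; _≤_; z≤n)
import Data.Nat.Properties as ℕ
open import Data.Nat.Induction using (<-rec)
open import Data.Fin as Fin using (toℕ; punchOut; _↑ˡ_; _↑ʳ_)
open import Data.Fin.Properties as Fin using (any?; _≟_)
open import Data.Fin.Permutation using (Permutation′; permutation)
open import Data.Vec as Vec using (Vec; []; _∷_; _++_; lookup; tabulate)
import Data.Vec.Properties as Vec
open import Data.Vec.Functional using (updateAt; tail) renaming (_∷_ to _∷ᶠ_)
open import Data.Vec.Functional.Properties using (updateAt-updates; updateAt-minimal)
open import Data.Product using (∃; _,_; proj₁; proj₂; uncurry)
open import Data.Sum using (_⊎_; inj₁; inj₂; [_,_])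
open import Function using (_∘_; id; const)
open import Function.Definitions using (Injective; StrictlySurjective)
open import Relation.Nullary using (¬_; yes; no; contradiction)
open import Relation.Nullary.Decidable using (Dec; _⊎-dec_)
open import Relation.Unary using (Pred; Decidable)
open import Relation.Binary.PropositionalEquality
  using (_≡_; _≢_; refl; sym; trans; cong; cong₂; subst; module ≡-Reasoning)

injective⇒strictlySurjective : ∀ {n} {f : Fin n → Fin n} →
  Injective _≡_ _≡_ f → StrictlySurjective _≡_ f
injective⇒strictlySurjective {suc n} {f} f-inj y with any? (λ x → f x ≟ y)
... | yes hit = hit
... | no miss = contradiction (Fin.injective⇒≤ g-inj) ℕ.1+n≰n
  where
  y≢f : ∀ x → y ≢ f x
  y≢f x y≡fx = miss (x , sym y≡fx)
  g : Fin (suc n) → Fin n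
  g x = punchOut (y≢f x)
  g-inj : Injective _≡_ _≡_ g
  g-inj eq = f-inj (Fin.punchOut-injective (y≢f _) (y≢f _) eq)

module _ {n} {f : Fin n → Fin n} where

  strictlySurjective⇒injective : StrictlySurjective _≡_ f → Injective _≡_ _≡_ f
  strictlySurjective⇒injective f-surj {x} {x′} fx≡fx′ = begin
    x           ≡⟨ g∘f x ⟨
    g (f x)     ≡⟨ cong g fx≡fx′ ⟩
    g (f x′)    ≡⟨ g∘f x′ ⟩
    x′          ∎
    where
    open ≡-Reasoning
    g : Fin n → Fin n
    g y = proj₁ (f-surj y)
    f∘g : ∀ y → f (g y) ≡ y
    f∘g y = proj₂ (f-surj y)
    g-inj : Injective _≡_ _≡_ g
    g-inj {y} {y′} gy≡gy′ = trans (sym (f∘g y)) (trans (cong f gy≡gy′) (f∘g y′))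
    g∘f : ∀ x → g (f x) ≡ x
    g∘f x with y , refl ← injective⇒strictlySurjective g-inj x = cong g (f∘g y)

  module _ (f-inj : Injective _≡_ _≡_ f) where

    opaque
      inverse : Fin n → Fin n
      inverse y = proj₁ (injective⇒strictlySurjective f-inj y)

      f∘inverse : ∀ y → f (inverse y) ≡ y
      f∘inverse y = proj₂ (injective⇒strictlySurjective f-inj y)

    inverse∘f : ∀ x → inverse (f x) ≡ x
    inverse∘f x = f-inj (f∘inverse (f x))

    injective⇒permutation : Permutation′ n
    injective⇒permutation = permutation f inverse f∘inverse inverse∘f

remQuot-injective : ∀ {m} k {t t′ : Fin (m * k)} → Fin.remQuot {m} k t ≡ Fin.remQuot k t′ → t ≡ t′
remQuot-injective {m} k {t} {t′} eq = trans (sym (Fin.combine-remQuot {m} k t))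
                                            (trans (cong (uncurry Fin.combine) eq) (Fin.combine-remQuot {m} k t′))

funToFin-cong : ∀ {k m} {f g : Fin k → Fin m} → (∀ i → f i ≡ g i) → Fin.funToFin f ≡ Fin.funToFin g
funToFin-cong {zero}  _   = refl
funToFin-cong {suc k} f≗g = cong₂ Fin.combine (f≗g Fin.zero) (funToFin-cong (f≗g ∘ Fin.suc))

finToFun-injective : ∀ {k m} {r r′ : Fin (m ^ k)} →
                     (∀ i → Fin.finToFun {m} {k} r i ≡ Fin.finToFun r′ i) → r ≡ r′
finToFun-injective {k} {m} {r} {r′} eq = trans (sym (Fin.funToFin-finToFin {k} {m} r))
                                               (trans (funToFin-cong eq) (Fin.funToFin-finToFin {k} {m} r′))

tabulate-injective : ∀ {a} {A : Set a} {k} {f g : Fin k → A} → tabulate f ≡ tabulate g → ∀ i → f i ≡ g i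
tabulate-injective {f = f} {g} eq i =
  trans (sym (Vec.lookup∘tabulate f i)) (trans (cong (λ v → lookup v i) eq) (Vec.lookup∘tabulate g i))

∃-least : ∀ {p} {P : Pred ℕ p} → Decidable P → ∀ {m} → P m → ∃ λ k → P k × (∀ {j} → j < k → ¬ P j)
∃-least {p} {P} P? {m} = <-rec (λ m → P m → Least) search m
  where
  Least : Set p
  Least = ∃ λ k → P k × (∀ {j} → j < k → ¬ P j)
  search : ∀ m → (∀ {j} → j < m → P j → Least) → P m → Least
  search m smaller Pm with ℕ.anyUpTo? P? m
  ... | yes (j , j<m , Pj) = smaller j<m Pj
  ... | no none            = m , Pm , λ j<m Pj → none (_ , j<m , Pj)

module Orbit {n} (f : Fin n → Fin n) (f-inj : Injective _≡_ _≡_ f) (x : Fin n) where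

  orbit : ℕ → Fin n
  orbit zero    = x
  orbit (suc j) = f (orbit j)

  orbit-cancelˡ : ∀ i {k l} → orbit (i + k) ≡ orbit (i + l) → orbit k ≡ orbit l
  orbit-cancelˡ zero    eq = eq
  orbit-cancelˡ (suc i) eq = orbit-cancelˡ i (f-inj eq)

  orbit-returns : ∃ λ m → orbit (suc m) ≡ x
  orbit-returns with Fin.pigeonhole (ℕ.n<1+n n) (orbit ∘ toℕ)
  ... | i , j , i<j , eq with ℕ.m≤n⇒∃[o]m+o≡n i<j
  ... | o , 1+i+o≡j = o , sym (orbit-cancelˡ (toℕ i) (begin
      orbit (toℕ i + 0)        ≡⟨ cong orbit (ℕ.+-identityʳ (toℕ i)) ⟩
      orbit (toℕ i)            ≡⟨ eq ⟩
      orbit (toℕ j)            ≡⟨ cong orbit 1+i+o≡j ⟨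
      orbit (suc (toℕ i) + o)  ≡⟨ cong orbit (ℕ.+-suc (toℕ i) o) ⟨
      orbit (toℕ i + suc o)    ∎))
    where open ≡-Reasoning

module FinAbGroupProperties {n : ℕ} (G : FinAbGroup n) where
  open FinAbGroup G public

  abelianGroup : AbelianGroup 0ℓ 0ℓ
  abelianGroup = record { isAbelianGroup = isAbelianGroup }

  open AbelianGroup abelianGroup public
    using (assoc; comm; identityˡ; identityʳ; inverseʳ; monoid; commutativeMonoid)
  open import Algebra.Properties.AbelianGroup abelianGroup public
    using (∙-cancelˡ; ∙-cancelʳ; ε⁻¹≈ε; inverseˡ-unique; \\-leftDividesˡ; //-rightDividesˡ; ⁻¹-∙-comm)
  open import Algebra.Properties.CommutativeSemigroup (AbelianGroup.commutativeSemigroup abelianGroup) public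
    using (interchange; x∙yz≈y∙xz; xy∙z≈xz∙y)
  open import Algebra.Properties.CommutativeMonoid.Sum commutativeMonoid public
    using (sum; sum-cong-≗; ∑-distrib-+; ∑-comm; sum-permute; sum-replicate; sum-replicate-zero)
  open import Algebra.Definitions.RawMonoid (AbelianGroup.rawMonoid abelianGroup) public
    using () renaming (_×_ to _×ₘ_)
  open import Algebra.Properties.Monoid.Mult monoid public
    using (×-homo-+)

  sumFin≡sum : ∀ {k} (f : Fin k → Fin n) → sumFin f ≡ sum f
  sumFin≡sum {zero}  f = refl
  sumFin≡sum {suc k} f = cong (f Fin.zero ⊕_) (sumFin≡sum (f ∘ Fin.suc))

  sumVec≡sum : ∀ {k} (x : Vec (Fin n) k) → sumVec x ≡ sum (lookup x)
  sumVec≡sum []      = refl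
  sumVec≡sum (g ∷ x) = cong (g ⊕_) (sumVec≡sum x)

  ·≡×ₘ : ∀ k x → k · x ≡ k ×ₘ x
  ·≡×ₘ zero    x = refl
  ·≡×ₘ (suc k) x = cong (x ⊕_) (·≡×ₘ k x)

  sumVec-tabulate : ∀ {k} (f : Fin k → Fin n) → sumVec (tabulate f) ≡ sum f
  sumVec-tabulate {zero}  f = refl
  sumVec-tabulate {suc k} f = cong (f Fin.zero ⊕_) (sumVec-tabulate (f ∘ Fin.suc))

  sum-↑ˡ-↑ʳ : ∀ k {l} (f : Fin (k + l) → Fin n) →
              sum f ≡ sum (f ∘ (_↑ˡ l)) ⊕ sum (f ∘ (k ↑ʳ_))
  sum-↑ˡ-↑ʳ zero    f = sym (identityˡ (sum f))
  sum-↑ˡ-↑ʳ (suc k) f = trans (cong (f Fin.zero ⊕_) (sum-↑ˡ-↑ʳ k (f ∘ Fin.suc)))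
                              (sym (assoc _ _ _))

  sum-×ₘ : ∀ k {l} (f : Fin l → Fin n) → sum (λ i → k ×ₘ f i) ≡ k ×ₘ sum f
  sum-×ₘ zero    {l} f = sum-replicate-zero l
  sum-×ₘ (suc k)     f = trans (∑-distrib-+ f (λ i → k ×ₘ f i)) (cong (sum f ⊕_) (sum-×ₘ k f))

  sum-injective : {f : Fin n → Fin n} → Injective _≡_ _≡_ f → sum f ≡ G₊
  sum-injective f-inj = trans (sym (sum-permute id (injective⇒permutation f-inj))) (sym (sumFin≡sum id))

  x-[d+1+e]x+dx+ex≡0 : ∀ d e x → ((x ⊕ (⊖ ((d + suc e) ×ₘ x))) ⊕ (d ×ₘ x)) ⊕ (e ×ₘ x) ≡ 0#
  x-[d+1+e]x+dx+ex≡0 d e x = begin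
    ((x ⊕ (⊖ X)) ⊕ (d ×ₘ x)) ⊕ (e ×ₘ x)      ≡⟨ assoc _ _ _ ⟩
    (x ⊕ (⊖ X)) ⊕ ((d ×ₘ x) ⊕ (e ×ₘ x))      ≡⟨ xy∙z≈xz∙y _ _ _ ⟩
    (x ⊕ ((d ×ₘ x) ⊕ (e ×ₘ x))) ⊕ (⊖ X)      ≡⟨ cong (_⊕ (⊖ X)) (x∙yz≈y∙xz _ _ _) ⟩
    ((d ×ₘ x) ⊕ (x ⊕ (e ×ₘ x))) ⊕ (⊖ X)      ≡⟨ cong (_⊕ (⊖ X)) (×-homo-+ x d (suc e)) ⟨
    X ⊕ (⊖ X)                                 ≡⟨ inverseʳ X ⟩
    0#                                        ∎
    where
    open ≡-Reasoning
    X : Fin n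
    X = (d + suc e) ×ₘ x

  sum-updateAt : ∀ {k} (f : Fin k → Fin n) p (h : Fin n → Fin n) →
                 h (f p) ⊕ sum f ≡ f p ⊕ sum (updateAt f p h)
  sum-updateAt f Fin.zero    h = x∙yz≈y∙xz (h (f Fin.zero)) (f Fin.zero) _
  sum-updateAt f (Fin.suc p) h = begin
    h (f (Fin.suc p)) ⊕ (f Fin.zero ⊕ _)   ≡⟨ x∙yz≈y∙xz _ _ _ ⟩
    f Fin.zero ⊕ (h (f (Fin.suc p)) ⊕ _)   ≡⟨ cong (f Fin.zero ⊕_) (sum-updateAt (f ∘ Fin.suc) p h) ⟩
    f Fin.zero ⊕ (f (Fin.suc p) ⊕ _)       ≡⟨ x∙yz≈y∙xz _ _ _ ⟩
    f (Fin.suc p) ⊕ (f Fin.zero ⊕ _)       ∎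
    where open ≡-Reasoning

module Realization {n : ℕ} (G : FinAbGroup n) where
  open FinAbGroupProperties G

  Realizable : (Fin n → Fin n) → Set
  Realizable a = ∃ λ b → Injective _≡_ _≡_ b × Injective _≡_ _≡_ (λ i → b i ⊕ a i)

  realizable-cong : ∀ {a a′} → (∀ i → a i ≡ a′ i) → Realizable a → Realizable a′
  realizable-cong a≗a′ (b , b-inj , c-inj) =
    b , b-inj , λ {i} {j} eq → c-inj (trans (cong (b i ⊕_) (a≗a′ i)) (trans eq (cong (b j ⊕_) (sym (a≗a′ j)))))

  realizable-0 : Realizable (const 0#)
  realizable-0 = id , id , λ {i} {j} eq → trans (sym (identityʳ i)) (trans eq (identityʳ j))

  -- Hall's exchange argument: follow v, f v, f² v, … up to the first return w to {u, v}, and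
  -- move b one step back and c one step forward along this chain.
  module Exchange
    (a a′ b : Fin n → Fin n) (b-inj : Injective _≡_ _≡_ b) (c-inj : Injective _≡_ _≡_ (λ i → b i ⊕ a i))
    {u v : Fin n} (u≢v : u ≢ v) (a′≡a : ∀ i → i ≢ u → i ≢ v → a′ i ≡ a i)
    (a′u+a′v : a′ u ⊕ a′ v ≡ a u ⊕ a v)
    where

    c : Fin n → Fin n
    c i = b i ⊕ a i

    K : Fin n
    K = (b u ⊕ a′ u) ⊕ b v

    f : Fin n → Fin n
    f z = inverse c-inj ((⊖ b z) ⊕ K)

    b+c∘f : ∀ z → b z ⊕ c (f z) ≡ K
    b+c∘f z = trans (cong (b z ⊕_) (f∘inverse c-inj ((⊖ b z) ⊕ K)))
                    (\\-leftDividesˡ (b z) K)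

    f-inj : Injective _≡_ _≡_ f
    f-inj {z} {z′} fz≡fz′ = b-inj (∙-cancelʳ (c (f z)) (b z) (b z′) (begin
      b z ⊕ c (f z)    ≡⟨ b+c∘f z ⟩
      K                ≡⟨ b+c∘f z′ ⟨
      b z′ ⊕ c (f z′)  ≡⟨ cong (λ y → b z′ ⊕ c y) fz≡fz′ ⟨
      b z′ ⊕ c (f z)   ∎))
      where open ≡-Reasoning

    pre : Fin n → Fin n
    pre = inverse f-inj

    b∘pre+a≡c∘f : ∀ i → b (pre i) ⊕ a i ≡ c (f i)
    b∘pre+a≡c∘f i = ∙-cancelˡ (b i) _ _ (begin
      b i ⊕ (b (pre i) ⊕ a i)      ≡⟨ x∙yz≈y∙xz (b i) (b (pre i)) (a i) ⟩
      b (pre i) ⊕ c i              ≡⟨ cong (λ y → b (pre i) ⊕ c y) (f∘inverse f-inj i) ⟨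
      b (pre i) ⊕ c (f (pre i))    ≡⟨ b+c∘f (pre i) ⟩
      K                            ≡⟨ b+c∘f i ⟨
      b i ⊕ c (f i)                ∎)
      where open ≡-Reasoning

    open Orbit f f-inj v

    Stop : ℕ → Set
    Stop j = orbit (suc j) ≡ u ⊎ orbit (suc j) ≡ v

    opaque
      chain : ∃ λ N → Stop N × (∀ {j} → j < N → ¬ Stop j)
      chain = ∃-least (λ j → orbit (suc j) ≟ u ⊎-dec orbit (suc j) ≟ v) {proj₁ orbit-returns}
                      (inj₂ (proj₂ orbit-returns))

    N : ℕ
    N = proj₁ chain

    w : Fin n
    w = orbit (suc N)

    w∈uv : w ≡ u ⊎ w ≡ v
    w∈uv = proj₁ (proj₂ chain)

    Interior : Fin n → Set
    Interior x = ∃ λ j → j < N × orbit (suc j) ≡ x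

    interior? : ∀ x → Dec (Interior x)
    interior? x = ℕ.anyUpTo? (λ j → orbit (suc j) ≟ x) N

    u∉interior : ¬ Interior u
    u∉interior (_ , j<N , eq) = proj₂ (proj₂ chain) j<N (inj₁ eq)

    v∉interior : ¬ Interior v
    v∉interior (_ , j<N , eq) = proj₂ (proj₂ chain) j<N (inj₂ eq)

    Init Tail : Fin n → Set
    Init x = Interior x ⊎ x ≡ v
    Tail x = Interior x ⊎ x ≡ w

    init-orbit : ∀ {j} → j ≤ N → Init (orbit j)
    init-orbit {zero}  _   = inj₂ refl
    init-orbit {suc j} j<N = inj₁ (j , j<N , refl)

    tail-orbit : ∀ {j} → j ≤ N → Tail (orbit (suc j))
    tail-orbit {j} j≤N with ℕ.m≤n⇒m<n∨m≡n j≤N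
    ... | inj₁ j<N  = inj₁ (j , j<N , refl)
    ... | inj₂ refl = inj₂ refl

    f-init⊆tail : ∀ {x} → Init x → Tail (f x)
    f-init⊆tail (inj₁ (j , j<N , refl)) = tail-orbit j<N
    f-init⊆tail (inj₂ refl)             = tail-orbit z≤n

    tail⊆f-init : ∀ {z} → Tail z → ∃ λ x → Init x × f x ≡ z
    tail⊆f-init (inj₁ (j , j<N , refl)) = orbit j , init-orbit (ℕ.<⇒≤ j<N) , refl
    tail⊆f-init (inj₂ refl)             = orbit N , init-orbit ℕ.≤-refl , refl

    σ : Fin n → Fin n
    σ x with interior? x | x ≟ v
    ... | yes _ | _     = pre x
    ... | no _  | yes _ = pre w
    ... | no _  | no _  = x

    σ-interior : ∀ {x} → Interior x → σ x ≡ pre x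
    σ-interior {x} x∈ with interior? x
    ... | yes _  = refl
    ... | no x∉ = contradiction x∈ x∉

    σ-v : σ v ≡ pre w
    σ-v with interior? v | v ≟ v
    ... | yes v∈ | _     = contradiction v∈ v∉interior
    ... | no _   | yes _ = refl
    ... | no _   | no v≢v = contradiction refl v≢v

    σ-fixed : ∀ {x} → ¬ Interior x → x ≢ v → σ x ≡ x
    σ-fixed {x} x∉ x≢v with interior? x | x ≟ v
    ... | yes x∈ | _       = contradiction x∈ x∉
    ... | no _   | yes x≡v = contradiction x≡v x≢v
    ... | no _   | no _    = refl

    σ-surjective : StrictlySurjective _≡_ σ
    σ-surjective z with interior? (f z) | f z ≟ w
    ... | yes fz∈ | _      = f z , trans (σ-interior fz∈) (inverse∘f f-inj z)
    ... | no _    | yes fz≡w = v , trans σ-v (trans (cong pre (sym fz≡w)) (inverse∘f f-inj z))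
    ... | no fz∉  | no fz≢w  = z , σ-fixed (λ z∈ → off-tail (inj₁ z∈)) (λ z≡v → off-tail (inj₂ z≡v))
      where
      off-tail : ¬ Init z
      off-tail z∈init = [ fz∉ , fz≢w ] (f-init⊆tail z∈init)

    b′ c′ : Fin n → Fin n
    b′ i = b (σ i)
    c′ i = b′ i ⊕ a′ i

    c′-interior : ∀ {i} → Interior i → c′ i ≡ c (f i)
    c′-interior {i} i∈ = begin
      b (σ i) ⊕ a′ i     ≡⟨ cong₂ (λ x y → b x ⊕ y) (σ-interior i∈) (a′≡a i i≢u i≢v) ⟩
      b (pre i) ⊕ a i    ≡⟨ b∘pre+a≡c∘f i ⟩
      c (f i)            ∎
      where
      open ≡-Reasoning
      i≢u : i ≢ u
      i≢u refl = u∉interior i∈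
      i≢v : i ≢ v
      i≢v refl = v∉interior i∈

    c′-u : c′ u ≡ c (f v)
    c′-u = begin
      b (σ u) ⊕ a′ u   ≡⟨ cong (λ x → b x ⊕ a′ u) (σ-fixed u∉interior u≢v) ⟩
      b u ⊕ a′ u       ≡⟨ ∙-cancelˡ (b v) _ _ (trans (comm (b v) _) (sym (b+c∘f v))) ⟩
      c (f v)          ∎
      where open ≡-Reasoning

    c′-v : c′ v ⊕ c w ≡ c u ⊕ c v
    c′-v = begin
      (b (σ v) ⊕ a′ v) ⊕ c w              ≡⟨ cong (λ x → (b x ⊕ a′ v) ⊕ c w) σ-v ⟩
      (b (pre w) ⊕ a′ v) ⊕ c w            ≡⟨ xy∙z≈xz∙y _ _ _ ⟩
      (b (pre w) ⊕ c w) ⊕ a′ v            ≡⟨ cong (λ y → (b (pre w) ⊕ c y) ⊕ a′ v) (f∘inverse f-inj w) ⟨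
      (b (pre w) ⊕ c (f (pre w))) ⊕ a′ v  ≡⟨ cong (_⊕ a′ v) (b+c∘f (pre w)) ⟩
      ((b u ⊕ a′ u) ⊕ b v) ⊕ a′ v         ≡⟨ cong (_⊕ a′ v) (xy∙z≈xz∙y _ _ _) ⟩
      ((b u ⊕ b v) ⊕ a′ u) ⊕ a′ v         ≡⟨ assoc _ _ _ ⟩
      (b u ⊕ b v) ⊕ (a′ u ⊕ a′ v)         ≡⟨ cong ((b u ⊕ b v) ⊕_) a′u+a′v ⟩
      (b u ⊕ b v) ⊕ (a u ⊕ a v)           ≡⟨ interchange _ _ _ _ ⟩
      c u ⊕ c v                           ∎
      where open ≡-Reasoning

    c′-fixed : ∀ {i} → ¬ Interior i → i ≢ u → i ≢ v → c′ i ≡ c i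
    c′-fixed i∉ i≢u i≢v = cong₂ (λ x y → b x ⊕ y) (σ-fixed i∉ i≢v) (a′≡a _ i≢u i≢v)

    c-pair : ∀ {x y} → x ≢ y → x ≡ u ⊎ x ≡ v → y ≡ u ⊎ y ≡ v → c x ⊕ c y ≡ c u ⊕ c v
    c-pair x≢y (inj₁ refl) (inj₁ refl) = contradiction refl x≢y
    c-pair x≢y (inj₁ refl) (inj₂ refl) = refl
    c-pair x≢y (inj₂ refl) (inj₁ refl) = comm _ _
    c-pair x≢y (inj₂ refl) (inj₂ refl) = contradiction refl x≢y

    c′-hits-tail : ∀ {z} → Tail z → ∃ λ i → c′ i ≡ c z
    c′-hits-tail z∈tail with tail⊆f-init z∈tail
    ... | x , inj₁ x∈   , refl = x , c′-interior x∈
    ... | _ , inj₂ refl , refl = u , c′-u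

    c′-hits-c : ∀ z → ∃ λ i → c′ i ≡ c z
    c′-hits-c z with interior? z | z ≟ w
    ... | yes z∈ | _       = c′-hits-tail (inj₁ z∈)
    ... | no _   | yes z≡w = c′-hits-tail (inj₂ z≡w)
    ... | no z∉  | no z≢w with z ≟ u | z ≟ v
    ...   | yes z≡u | _       = v , ∙-cancelʳ (c w) _ _ (trans c′-v (sym (c-pair z≢w (inj₁ z≡u) w∈uv)))
    ...   | no _    | yes z≡v = v , ∙-cancelʳ (c w) _ _ (trans c′-v (sym (c-pair z≢w (inj₂ z≡v) w∈uv)))
    ...   | no z≢u  | no z≢v  = z , c′-fixed z∉ z≢u z≢v

    realizable : Realizable a′
    realizable = b′ , b-inj′ , strictlySurjective⇒injective c′-surjective
      where
      b-inj′ : Injective _≡_ _≡_ b′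
      b-inj′ eq = strictlySurjective⇒injective σ-surjective (b-inj eq)
      c′-surjective : StrictlySurjective _≡_ c′
      c′-surjective y with i , hit ← c′-hits-c (inverse c-inj y) = i , trans hit (f∘inverse c-inj y)

module HallInduction {n : ℕ} (G : FinAbGroup (suc n)) where
  open FinAbGroupProperties G
  open Realization G

  balance : (Fin n → Fin (suc n)) → Fin (suc n) → Fin (suc n)
  balance g = (⊖ sum g) ∷ᶠ g

  realizable-balance : ∀ k → k ≤ n → (g : Fin n → Fin (suc n)) → (∀ i → k ≤ toℕ i → g i ≡ 0#) →
                       Realizable (balance g)
  realizable-balance zero    _   g g≡0 = realizable-cong balance≡0 realizable-0
    where
    balance≡0 : ∀ i → 0# ≡ balance g i
    balance≡0 Fin.zero = begin
      0#                     ≡⟨ ε⁻¹≈ε ⟨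
      ⊖ 0#                   ≡⟨ cong ⊖_ (sum-replicate-zero n) ⟨
      ⊖ sum {n} (const 0#)   ≡⟨ cong ⊖_ (sum-cong-≗ (λ i → g≡0 i z≤n)) ⟨
      ⊖ sum g                ∎
      where open ≡-Reasoning
    balance≡0 (Fin.suc i) = sym (g≡0 i z≤n)
  realizable-balance (suc k) k<n g g≡0 =
    let b , b-inj , c-inj = realizable-balance k (ℕ.<⇒≤ k<n) g′ g′≡0
    in  Exchange.realizable (balance g′) (balance g) b b-inj c-inj (λ ()) agree pair-sum
    where
    p : Fin n
    p = Fin.fromℕ< k<n
    g′ : Fin n → Fin (suc n)
    g′ = updateAt g p (const 0#)
    g′≡0 : ∀ i → k ≤ toℕ i → g′ i ≡ 0#
    g′≡0 i k≤i with i ≟ p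
    ... | yes refl = updateAt-updates p g
    ... | no i≢p   = trans (updateAt-minimal i p g i≢p) (g≡0 i (ℕ.≤∧≢⇒< k≤i k≢i))
      where
      k≢i : k ≢ toℕ i
      k≢i k≡i = i≢p (Fin.toℕ-injective (trans (sym k≡i) (sym (Fin.toℕ-fromℕ< k<n))))
    agree : ∀ i → i ≢ Fin.suc p → i ≢ Fin.zero → balance g i ≡ balance g′ i
    agree Fin.zero    _      i≢0 = contradiction refl i≢0
    agree (Fin.suc i) i≢1+p  _   = sym (updateAt-minimal i p g (i≢1+p ∘ cong Fin.suc))
    pair-sum : g p ⊕ (⊖ sum g) ≡ g′ p ⊕ (⊖ sum g′)
    pair-sum = begin
      g p ⊕ (⊖ sum g)                   ≡⟨ cong (λ s → g p ⊕ (⊖ s)) (trans (sym (identityˡ _)) (sum-updateAt g p (const 0#))) ⟩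
      g p ⊕ (⊖ (g p ⊕ sum g′))          ≡⟨ cong (g p ⊕_) (⁻¹-∙-comm (g p) (sum g′)) ⟨
      g p ⊕ ((⊖ g p) ⊕ (⊖ sum g′))      ≡⟨ \\-leftDividesˡ (g p) (⊖ sum g′) ⟩
      ⊖ sum g′                          ≡⟨ identityˡ _ ⟨
      0# ⊕ (⊖ sum g′)                   ≡⟨ cong (_⊕ (⊖ sum g′)) (updateAt-updates p g) ⟨
      g′ p ⊕ (⊖ sum g′)                 ∎
      where open ≡-Reasoning

  realizable : ∀ a → sum a ≡ 0# → Realizable a
  realizable a Σa≡0 = realizable-cong balanced (realizable-balance n ℕ.≤-refl (tail a) none-beyond-n)
    where
    none-beyond-n : ∀ i → n ≤ toℕ i → tail a i ≡ 0#
    none-beyond-n i n≤i = contradiction (Fin.toℕ<n i) (ℕ.≤⇒≯ n≤i)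
    balanced : ∀ i → balance (tail a) i ≡ a i
    balanced Fin.zero    = sym (inverseˡ-unique (a Fin.zero) (sum (tail a)) Σa≡0)
    balanced (Fin.suc i) = refl

hall : ∀ {n} (G : FinAbGroup n) (a : Fin n → Fin n) →
       FinAbGroupProperties.sum G a ≡ FinAbGroup.0# G → Realization.Realizable G a
hall {zero}  G a _   = (λ ()) , (λ { {()} }) , (λ { {()} })
hall {suc n} G       = HallInduction.realizable G

++-isDiagonal : ∀ {n d e} {p : Fin n → Pos n d} {q : Fin n → Pos n e} → IsDiagonal p →
                (∀ ℓ → Injective _≡_ _≡_ (λ k → lookup (q k) ℓ)) → IsDiagonal (λ k → p k ++ q k)
++-isDiagonal {d = d} {p = p} {q} (p-inj , p-coord) q-coord =
  (λ eq → p-inj (Vec.++-injectiveˡ (p _) (p _) eq)) , coordinate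
  where
  coordinate : ∀ i → Injective _≡_ _≡_ (λ k → lookup (p k ++ q k) i)
  coordinate i {k} {k′} eq
    with Fin.splitAt d i | Vec.lookup-splitAt d (p k) (q k) i | Vec.lookup-splitAt d (p k′) (q k′) i
  ... | inj₁ i′ | at-k | at-k′ = p-coord i′ (trans (sym at-k) (trans eq at-k′))
  ... | inj₂ ℓ  | at-k | at-k′ = q-coord ℓ (trans (sym at-k) (trans eq at-k′))

module Extension {n : ℕ} (G : FinAbGroup n) where
  open FinAbGroupProperties G

  module _ {d e : ℕ} (L : Hypercube n d) (le : d ≤ d + e) where

    -- The summands `extra` of `extension` are where-bound; unification recovers them.
    private
      summandsOf : ∀ {k} {s x : Fin n} {t : Fin k → Fin n} → s ≡ x ⊕ sumFin t → Fin k → Fin n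
      summandsOf {t = t} _ = t

    extraCoordinates : Pos n (d + e) → Fin (d + e) → Fin n
    extraCoordinates x = summandsOf (refl {x = extension G (d + e) le L x})

    extraCoordinates-↑ˡ : ∀ x i → extraCoordinates x (i ↑ˡ e) ≡ 0#
    extraCoordinates-↑ˡ x i with toℕ (i ↑ˡ e) ℕ.<? d
    ... | yes _   = refl
    ... | no i≮d = contradiction (subst (_< d) (sym (Fin.toℕ-↑ˡ i e)) (Fin.toℕ<n i)) i≮d

    extraCoordinates-↑ʳ : ∀ x j → extraCoordinates x (d ↑ʳ j) ≡ lookup x (d ↑ʳ j)
    extraCoordinates-↑ʳ x j with toℕ (d ↑ʳ j) ℕ.<? d
    ... | yes d+j<d = contradiction (subst (_< d) (Fin.toℕ-↑ʳ d j) d+j<d) (ℕ.m+n≮m d (toℕ j))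
    ... | no _      = refl

    prefix-++ : ∀ (x : Pos n d) (y : Pos n e) → tabulate (λ i → lookup (x ++ y) (Fin.inject≤ i le)) ≡ x
    prefix-++ x y = trans (Vec.tabulate-cong λ i → trans (cong (lookup (x ++ y)) (inject≤≡↑ˡ i))
                                                         (Vec.lookup-++ˡ x y i))
                          (Vec.tabulate∘lookup x)
      where
      inject≤≡↑ˡ : ∀ i → Fin.inject≤ i le ≡ i ↑ˡ e
      inject≤≡↑ˡ i = Fin.toℕ-injective (trans (Fin.toℕ-inject≤ i le) (sym (Fin.toℕ-↑ˡ i e)))

    sum-extraCoordinates-++ : ∀ (x : Pos n d) (y : Pos n e) → sum (extraCoordinates (x ++ y)) ≡ sumVec y
    sum-extraCoordinates-++ x y = begin
      sum t                                    ≡⟨ sum-↑ˡ-↑ʳ d t ⟩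
      sum (t ∘ (_↑ˡ e)) ⊕ sum (t ∘ (d ↑ʳ_))    ≡⟨ cong₂ _⊕_ (sum-cong-≗ (extraCoordinates-↑ˡ (x ++ y)))
                                                            (sum-cong-≗ t∘↑ʳ≗y) ⟩
      sum {d} (const 0#) ⊕ sum (lookup y)      ≡⟨ cong₂ _⊕_ (sum-replicate-zero d) (sym (sumVec≡sum y)) ⟩
      0# ⊕ sumVec y                            ≡⟨ identityˡ _ ⟩
      sumVec y                                 ∎
      where
      open ≡-Reasoning
      t : Fin (d + e) → Fin n
      t = extraCoordinates (x ++ y)
      t∘↑ʳ≗y : ∀ j → t (d ↑ʳ j) ≡ lookup y j
      t∘↑ʳ≗y j = trans (extraCoordinates-↑ʳ (x ++ y) j) (Vec.lookup-++ʳ x y j)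

    extension-++ : ∀ (x : Pos n d) (y : Pos n e) → extension G (d + e) le L (x ++ y) ≡ L x ⊕ sumVec y
    extension-++ x y = cong₂ _⊕_ (cong L (prefix-++ x y))
                                 (trans (sumFin≡sum (extraCoordinates (x ++ y))) (sum-extraCoordinates-++ x y))

    ++-isTransversal : {p : Fin n → Pos n d} {q : Fin n → Pos n e} → IsDiagonal p →
                       (∀ ℓ → Injective _≡_ _≡_ (λ k → lookup (q k) ℓ)) →
                       Injective _≡_ _≡_ (λ k → L (p k) ⊕ sumVec (q k)) →
                       IsTransversal (extension G (d + e) le L) (λ k → p k ++ q k)
    ++-isTransversal p-diag q-coord symbol-inj =
      ++-isDiagonal p-diag q-coord ,
      λ eq → symbol-inj (trans (sym (extension-++ _ _)) (trans eq (extension-++ _ _)))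

  diagonal-sum : ∀ {d} {p : Fin n → Pos n d} → IsDiagonal p → sum (λ k → sumVec (p k)) ≡ d ×ₘ G₊
  diagonal-sum {d} {p} (_ , coordinate-inj) = begin
    sum (λ k → sumVec (p k))                  ≡⟨ sum-cong-≗ (λ k → sumVec≡sum (p k)) ⟩
    sum (λ k → sum (lookup (p k)))            ≡⟨ ∑-comm (λ k i → lookup (p k) i) ⟩
    sum (λ i → sum (λ k → lookup (p k) i))    ≡⟨ sum-cong-≗ (λ i → sum-injective (coordinate-inj i)) ⟩
    sum {d} (const G₊)                        ≡⟨ sum-replicate d ⟩
    d ×ₘ G₊                                   ∎
    where open ≡-Reasoning

  module Transversals {d e m : ℕ} (L : Hypercube n d) (le : d ≤ d + suc e)
    (D : Fin m → Fin n → Pos n d) (D-suitable : ∀ j → IsSuitable G (d + suc e) L (D j))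
    (D-disjoint : PairwiseDisjoint D)
    where

    a : Fin m → Fin n → Fin n
    a j k = L (D j k) ⊕ (e ×ₘ k)

    sum-a≡0 : ∀ j → sum (a j) ≡ 0#
    sum-a≡0 j = begin
      sum (λ k → L (D j k) ⊕ (e ×ₘ k))                           ≡⟨ ∑-distrib-+ (L ∘ D j) (e ×ₘ_) ⟩
      sum (L ∘ D j) ⊕ sum (e ×ₘ_)                                ≡⟨ cong₂ _⊕_ sum-L sum-e×ₘ ⟩
      ((G₊ ⊕ (⊖ ((d + suc e) ×ₘ G₊))) ⊕ (d ×ₘ G₊)) ⊕ (e ×ₘ G₊)   ≡⟨ x-[d+1+e]x+dx+ex≡0 d e G₊ ⟩
      0#                                                         ∎
      where
      open ≡-Reasoning
      Δs sVs : Fin n → Fin n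
      Δs k = Δ G L (D j k)
      sVs k = sumVec (D j k)
      sum-Δ : sum Δs ≡ G₊ ⊕ (⊖ ((d + suc e) ×ₘ G₊))
      sum-Δ = begin
        sum Δs                          ≡⟨ sumFin≡sum Δs ⟨
        sumFin Δs                       ≡⟨ proj₂ (D-suitable j) ⟩
        G₊ ⊕ (⊖ ((d + suc e) · G₊))     ≡⟨ cong (λ x → G₊ ⊕ (⊖ x)) (·≡×ₘ (d + suc e) G₊) ⟩
        G₊ ⊕ (⊖ ((d + suc e) ×ₘ G₊))    ∎
      sum-L : sum (L ∘ D j) ≡ (G₊ ⊕ (⊖ ((d + suc e) ×ₘ G₊))) ⊕ (d ×ₘ G₊)
      sum-L = begin
        sum (L ∘ D j)                               ≡⟨ sum-cong-≗ (λ k → //-rightDividesˡ (sVs k) (L (D j k))) ⟨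
        sum (λ k → Δs k ⊕ sVs k)                    ≡⟨ ∑-distrib-+ Δs sVs ⟩
        sum Δs ⊕ sum sVs                            ≡⟨ cong₂ _⊕_ sum-Δ (diagonal-sum (proj₁ (D-suitable j))) ⟩
        (G₊ ⊕ (⊖ ((d + suc e) ×ₘ G₊))) ⊕ (d ×ₘ G₊)  ∎
      sum-e×ₘ : sum (e ×ₘ_) ≡ e ×ₘ G₊
      sum-e×ₘ = trans (sum-×ₘ e id) (cong (e ×ₘ_) (sym (sumFin≡sum id)))

    β : Fin m → Fin n → Fin n
    β j = proj₁ (hall G (a j) (sum-a≡0 j))

    β-injective : ∀ j → Injective _≡_ _≡_ (β j)
    β-injective j = proj₁ (proj₂ (hall G (a j) (sum-a≡0 j)))

    β+a-injective : ∀ j → Injective _≡_ _≡_ (λ k → β j k ⊕ a j k)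
    β+a-injective j = proj₂ (proj₂ (hall G (a j) (sum-a≡0 j)))

    newCoordinates : Fin m → Fin n → Fin (suc e) → Fin n
    newCoordinates j k = β j k ∷ᶠ const k

    newCoordinates-injective : ∀ j ℓ → Injective _≡_ _≡_ (λ k → newCoordinates j k ℓ)
    newCoordinates-injective j Fin.zero    = β-injective j
    newCoordinates-injective j (Fin.suc _) = id

    shifted : Fin m → (Fin (suc e) → Fin n) → Fin n → Fin (suc e) → Fin n
    shifted j s k ℓ = newCoordinates j k ℓ ⊕ s ℓ

    transversal : Fin m → (Fin (suc e) → Fin n) → Fin n → Pos n (d + suc e)
    transversal j s k = D j k ++ tabulate (shifted j s k)

    symbol : ∀ j s k → L (D j k) ⊕ sumVec (tabulate (shifted j s k)) ≡ (β j k ⊕ a j k) ⊕ sum s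
    symbol j s k = begin
      l ⊕ sumVec (tabulate (shifted j s k))      ≡⟨ cong (l ⊕_) (sumVec-tabulate (shifted j s k)) ⟩
      l ⊕ sum (shifted j s k)                    ≡⟨ cong (l ⊕_) (∑-distrib-+ (newCoordinates j k) s) ⟩
      l ⊕ ((β j k ⊕ sum {e} (const k)) ⊕ sum s)  ≡⟨ cong (λ x → l ⊕ ((β j k ⊕ x) ⊕ sum s)) (sum-replicate e) ⟩
      l ⊕ ((β j k ⊕ (e ×ₘ k)) ⊕ sum s)           ≡⟨ assoc _ _ _ ⟨
      (l ⊕ (β j k ⊕ (e ×ₘ k))) ⊕ sum s           ≡⟨ cong (_⊕ sum s) (x∙yz≈y∙xz _ _ _) ⟩
      (β j k ⊕ a j k) ⊕ sum s                    ∎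
      where
      open ≡-Reasoning
      l : Fin n
      l = L (D j k)

    transversal-isTransversal : ∀ j s → IsTransversal (extension G (d + suc e) le L) (transversal j s)
    transversal-isTransversal j s =
      ++-isTransversal L le (proj₁ (D-suitable j)) coordinate-inj symbol-inj
      where
      coordinate-inj : ∀ ℓ → Injective _≡_ _≡_ (λ k → lookup (tabulate (shifted j s k)) ℓ)
      coordinate-inj ℓ {k} {k′} eq = newCoordinates-injective j ℓ (∙-cancelʳ (s ℓ) _ _ (begin
        shifted j s k ℓ                      ≡⟨ Vec.lookup∘tabulate (shifted j s k) ℓ ⟨
        lookup (tabulate (shifted j s k)) ℓ  ≡⟨ eq ⟩
        lookup (tabulate (shifted j s k′)) ℓ ≡⟨ Vec.lookup∘tabulate (shifted j s k′) ℓ ⟩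
        shifted j s k′ ℓ                     ∎))
        where open ≡-Reasoning
      symbol-inj : Injective _≡_ _≡_ (λ k → L (D j k) ⊕ sumVec (tabulate (shifted j s k)))
      symbol-inj {k} {k′} eq =
        β+a-injective j (∙-cancelʳ (sum s) _ _ (trans (sym (symbol j s k)) (trans eq (symbol j s k′))))

    transversal-injective : ∀ {j j′ s s′ k k′} → transversal j s k ≡ transversal j′ s′ k′ →
                            j ≡ j′ × (∀ ℓ → s ℓ ≡ s′ ℓ)
    transversal-injective {j} {j′} {s} {s′} {k} {k′} eq with j ≟ j′
    ... | no j≢j′  = contradiction (Vec.++-injectiveˡ (D j k) (D j′ k′) eq) (D-disjoint j j′ j≢j′ k k′)
    ... | yes refl with refl ← proj₁ (proj₁ (D-suitable j)) (Vec.++-injectiveˡ (D j k) (D j k′) eq) =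
      refl , λ ℓ → ∙-cancelˡ (newCoordinates j k ℓ) _ _
                     (tabulate-injective {f = shifted j s k} {g = shifted j s′ k} (Vec.++-injectiveʳ (D j k) (D j k) eq) ℓ)

    index : Fin (m * n ^ suc e) → Fin m × Fin (n ^ suc e)
    index = Fin.remQuot {m} (n ^ suc e)

    shift : Fin (n ^ suc e) → Fin (suc e) → Fin n
    shift = Fin.finToFun {n} {suc e}

    indexed : Fin (m * n ^ suc e) → Fin n → Pos n (d + suc e)
    indexed t = transversal (proj₁ (index t)) (shift (proj₂ (index t)))

    indexed-disjoint : PairwiseDisjoint indexed
    indexed-disjoint t t′ t≢t′ k k′ eq = t≢t′ (remQuot-injective (n ^ suc e)
      (cong₂ _,_ (proj₁ same-transversal) (finToFun-injective (proj₂ same-transversal))))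
      where
      same-transversal : proj₁ (index t) ≡ proj₁ (index t′) ×
                         (∀ ℓ → shift (proj₂ (index t)) ℓ ≡ shift (proj₂ (index t′)) ℓ)
      same-transversal = transversal-injective {s = shift (proj₂ (index t))} {s′ = shift (proj₂ (index t′))} eq

  extension-transversals : ∀ {d e m} (L : Hypercube n d) (le : d ≤ d + suc e) (D : Fin m → Fin n → Pos n d) →
    (∀ j → IsSuitable G (d + suc e) L (D j)) → PairwiseDisjoint D →
    Σ (Fin (m * n ^ suc e) → Fin n → Pos n (d + suc e)) (λ T →
      (∀ t → IsTransversal (extension G (d + suc e) le L) (T t)) × PairwiseDisjoint T)
  extension-transversals L le D D-suitable D-disjoint =
    indexed , (λ t → transversal-isTransversal (proj₁ (index t)) (shift (proj₂ (index t)))) , indexed-disjoint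
    where open Transversals L le D D-suitable D-disjoint

corollary3p4 : ∀ {n : ℕ} (G : FinAbGroup n) (d d' m : ℕ) (L : Hypercube n d)
    → IsLatin L
    → (d<d' : d < d')
    → (D : Fin m → Fin n → Pos n d)
    → (∀ j → IsSuitable G d' L (D j))
    → PairwiseDisjoint D
    → Σ (Fin (m * n ^ (d' ∸ d)) → Fin n → Pos n d') (λ T →
        (∀ t → IsTransversal (extension G d' (<⇒≤ d<d') L) (T t)) × PairwiseDisjoint T)
corollary3p4 G d d' m L _ d<d' D D-suitable D-disjoint
  with d' ∸ d | ℕ.m+[n∸m]≡n (<⇒≤ d<d') | ℕ.m<n⇒0<n∸m d<d'
... | suc e | refl | _ = Extension.extension-transversals G L (<⇒≤ d<d') D D-suitable D-disjoint
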